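{- Let $m\geq 4$ and let $G=\Theta(s_1,s_2^{m-1})$ be the generalized theta graph with one path having $s_1$ internal vertices and $m-1$ paths having $s_2$ internal vertices, where $s_1<s_2$. Then $m-2\leq\beta(G)\leq m-1$.
   Context: Graphs are simple, connected, finite. A set $W\subseteq V(G)$ is resolving if for any distinct $u,v$ there is $w\in W$ with $d(u,w)\ne d(v,w)$; $\beta(G)$ is the minimum size of a resolving set. A generalized theta graph consists of two vertices $c_1,c_2$ (centers) joined by internally disjoint paths; a path with $s$ internal vertices has length $s+1$. -}

module Defs where

open import Data.Nat using (ℕ; zero; suc; _≤_)
open import Data.Fin using (Fin; toℕ)
open import Data.List using (List; length)
open import Data.List.Membership.Propositional using (_∈_)
open import Data.List.Relation.Unary.Unique.Propositional using (Unique)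
open import Data.Product using (Σ; ∃; _×_; _,_)
open import Data.Sum using (_⊎_)
open import Relation.Binary.PropositionalEquality using (_≡_; _≢_)

module GraphNotions {V : Set} (Adj : V → V → Set) where

  data Walk : V → V → ℕ → Set where
    here : ∀ {u} → Walk u u 0
    step : ∀ {u v w n} → Adj u v → Walk v w n → Walk u w (suc n)

  IsDist : V → V → ℕ → Set
  IsDist u v k = Walk u v k × (∀ n → Walk u v n → k ≤ n)

  Resolving : List V → Set
  Resolving W = ∀ u v → u ≢ v →
    Σ V λ w → w ∈ W × Σ ℕ λ d₁ → Σ ℕ λ d₂ →
      IsDist u w d₁ × IsDist v w d₂ × d₁ ≢ d₂

  IsMetricDim : ℕ → Set
  IsMetricDim b =
    (Σ (List V) λ W → Unique W × Resolving W × length W ≡ b) ×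
    (∀ (W : List V) → Unique W → Resolving W → b ≤ length W)

module Theta (m : ℕ) (len : Fin m → ℕ) where

  data ThetaV : Set where
    c₁ c₂ : ThetaV
    inner : (i : Fin m) → Fin (len i) → ThetaV

  -- path i: c₁ - x₀ - x₁ - ... - x_{len i - 1} - c₂  (or c₁ - c₂ if len i = 0)
  data Edge : ThetaV → ThetaV → Set where
    direct : (i : Fin m) → len i ≡ 0 → Edge c₁ c₂
    first  : (i : Fin m) (j : Fin (len i)) → toℕ j ≡ 0 → Edge c₁ (inner i j)
    next   : (i : Fin m) (j k : Fin (len i)) → suc (toℕ j) ≡ toℕ k →
             Edge (inner i j) (inner i k)
    last   : (i : Fin m) (j : Fin (len i)) → suc (toℕ j) ≡ len i →
             Edge (inner i j) c₂

  Adj : ThetaV → ThetaV → Set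
  Adj u v = Edge u v ⊎ Edge v u

  open GraphNotions Adj public

thetaLens : (s₁ s₂ : ℕ) (m : ℕ) → Fin m → ℕ
thetaLens s₁ s₂ (suc m) Fin.zero    = s₁
thetaLens s₁ s₂ (suc m) (Fin.suc _) = s₂

-- Lower bound: exchanging two long paths is an automorphism of G. If W contains no vertex of two of the
-- long paths, the exchange fixes W pointwise but moves the first vertex of one of them, so W cannot resolve
-- that vertex from its image. Hence a resolving set meets all but at most one of the m - 1 long paths.
--
-- Upper bound: with e = s₂ - s₁ - 1 and t = ⌊(e - 1)/2⌋, the centre c₂ together with the vertex at position t
-- of every long path but one resolves G. All distances are certified by 1-Lipschitz potentials: a function
-- vanishing at w, changing by at most one along each edge and realised by a walk from every vertex, is d(·, w).
-- A landmark sees a vertex off its own path at distance d(·, c₁) + t + 1 and a vertex on its own path strictly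
-- closer; together with the injectivity of (d(·, c₁), d(·, c₂)) on each path this separates every pair that
-- c₂ does not.
--
-- Since resolving sets of a fixed size can be searched for exhaustively, β is then pinned down to m - 2 or m - 1.
module Submission where

open import Defs
open import Data.Nat using (ℕ; zero; suc; _+_; _∸_; _≤_; _<_; _⊓_; z≤n; s≤s; ≢-nonZero; ∣_-_∣; ⌊_/2⌋; ⌈_/2⌉)
open import Data.Nat.Properties
import Data.Nat.Properties as ℕ
open import Data.Nat.Tactic.RingSolver using (solve-∀)
open import Data.Fin using (Fin; zero; suc; toℕ; fromℕ<)
open import Data.Fin.Properties using (toℕ-fromℕ<; toℕ-injective; toℕ<n; pigeonhole; ¬∀⟶∃¬) renaming (_≟_ to _≟ᶠ_)
import Data.Fin.Properties as Fin
open import Data.Fin.Permutation.Components using (transpose; transpose-inverse)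
open import Data.Maybe using (Maybe; just; nothing)
import Data.Maybe.Relation.Unary.Any as MaybeAny
open import Data.List using (List; []; _∷_; length; map; mapMaybe; concatMap; allFin; cartesianProductWith)
open import Data.List.Properties using (length-map; length-tabulate; length-mapMaybe)
open import Data.List.Membership.Propositional using (_∈_; _∉_; lose; find)
open import Data.List.Membership.Propositional.Properties using (∈-map⁺; ∈-concatMap⁺; ∈-allFin; ∈-cartesianProductWith⁺)
import Data.List.Membership.DecPropositional as DecMembership
open import Data.List.Membership.Setoid.Properties using (index-injective)
open import Data.List.Relation.Unary.Any using (Any; here; there; any?; index)
import Data.List.Relation.Unary.Any as Any
open import Data.List.Relation.Unary.Any.Properties using (mapMaybe⁺; map⁺)
open import Data.List.Relation.Unary.All using (All; all?; lookup; tabulate)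
import Data.List.Relation.Unary.All.Properties as Allₚ
open import Data.List.Relation.Unary.AllPairs using (_∷_)
open import Data.List.Relation.Unary.Unique.Propositional using (Unique)
import Data.List.Relation.Unary.Unique.Propositional.Properties as Uniqueₚ
import Data.List.Relation.Unary.Unique.DecPropositional as UniqueDec
open import Data.Product using (Σ; ∃; ∃₂; _×_; _,_; proj₁; proj₂)
open import Data.Sum using (_⊎_; inj₁; inj₂)
open import Function using (_∘_)
open import Relation.Nullary using (Dec; yes; no; ¬_; contradiction)
open import Relation.Nullary.Decidable using (¬?; _×-dec_; dec-true; dec-false)
open import Relation.Binary.Definitions using (DecidableEquality)
open import Relation.Binary.PropositionalEquality
  using (_≡_; _≢_; refl; sym; trans; cong; cong₂; subst; subst₂; setoid; module ≡-Reasoning)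

least-satisfying : (P : ℕ → Set) → (∀ n → Dec (P n)) → ∀ {N} → P N →
                   Σ ℕ λ d → P d × (∀ n → P n → d ≤ n)
least-satisfying P P? {zero} p = 0 , p , λ _ _ → z≤n
least-satisfying P P? {suc N} p with P? 0
... | yes p₀ = 0 , p₀ , λ _ _ → z≤n
... | no ¬p₀ with least-satisfying (λ n → P (suc n)) (λ n → P? (suc n)) p
...   | d , pd , d-least = suc d , pd , least
  where
  least : ∀ n → P n → suc d ≤ n
  least zero q = contradiction q ¬p₀
  least (suc n) q = s≤s (d-least n q)

module GraphFacts {V : Set} (Adj : V → V → Set) where

  open GraphNotions Adj

  IsDist-unique : ∀ {u w a b} → IsDist u w a → IsDist u w b → a ≡ b
  IsDist-unique (wa , a-least) (wb , b-least) = ≤-antisym (a-least _ wb) (b-least _ wa)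

  _++ʷ_ : ∀ {u v w a b} → Walk u v a → Walk v w b → Walk u w (a + b)
  here ++ʷ q = q
  step x p ++ʷ q = step x (p ++ʷ q)

  min-walk : ∀ {u v a b} → Walk u v a → Walk u v b → Walk u v (a ⊓ b)
  min-walk {a = a} {b} p q with ⊓-sel a b
  ... | inj₁ a⊓b≡a = subst (Walk _ _) (sym a⊓b≡a) p
  ... | inj₂ a⊓b≡b = subst (Walk _ _) (sym a⊓b≡b) q

  module Undirected (Adj-sym : ∀ {u v} → Adj u v → Adj v u) where

    snoc : ∀ {u v w a} → Walk u v a → Adj v w → Walk u w (suc a)
    snoc here x = step x here
    snoc (step y p) x = step y (snoc p x)

    reverse : ∀ {u v a} → Walk u v a → Walk v u a
    reverse here = here
    reverse (step x p) = snoc (reverse p) (Adj-sym x)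

  Lipschitz : (V → ℕ) → Set
  Lipschitz f = ∀ {u v} → Adj u v → f u ≤ suc (f v)

  Lipschitz⇒≤walk : ∀ {f} → Lipschitz f → ∀ {u w n} → Walk u w n → f u ≤ n + f w
  Lipschitz⇒≤walk L here = ≤-refl
  Lipschitz⇒≤walk L (step x p) = ≤-trans (L x) (s≤s (Lipschitz⇒≤walk L p))

  potential⇒IsDist : ∀ {f w} → Lipschitz f → f w ≡ 0 → ∀ {x} → Walk x w (f x) → IsDist x w (f x)
  potential⇒IsDist {f} L fw≡0 p = p , λ n q →
    ≤-trans (Lipschitz⇒≤walk L q) (≤-reflexive (trans (cong (n +_) fw≡0) (+-identityʳ n)))

  map-walk : (f : V → V) → (∀ {u v} → Adj u v → Adj (f u) (f v)) → ∀ {u v n} → Walk u v n → Walk (f u) (f v) n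
  map-walk f f-adj here = here
  map-walk f f-adj (step x p) = step (f-adj x) (map-walk f f-adj p)

  module AdjacencyPreserving (σ τ : V → V) (σ-adj : ∀ {u v} → Adj u v → Adj (σ u) (σ v))
    (τ-adj : ∀ {u v} → Adj u v → Adj (τ u) (τ v)) (τ∘σ : ∀ x → τ (σ x) ≡ x) where

    σ-preserves-IsDist : ∀ {u w d} → IsDist u w d → IsDist (σ u) (σ w) d
    σ-preserves-IsDist {u} {w} (p , least) = map-walk σ σ-adj p , λ n q →
      least n (subst₂ (λ a b → Walk a b n) (τ∘σ u) (τ∘σ w) (map-walk τ τ-adj q))

    fixing⇒¬Resolving : ∀ {W u} → (∀ {w} → w ∈ W → σ w ≡ w) → u ≢ σ u → ¬ Resolving W
    fixing⇒¬Resolving {W} {u} fixes u≢σu resolves with resolves u (σ u) u≢σu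
    ... | w , w∈W , d₁ , d₂ , u-w , σu-w , d₁≢d₂ =
      d₁≢d₂ (IsDist-unique (subst (λ x → IsDist (σ u) x d₁) (fixes w∈W) (σ-preserves-IsDist u-w)) σu-w)

  ResolvingSetOfSize : ℕ → Set
  ResolvingSetOfSize k = Σ (List V) λ W → Unique W × Resolving W × length W ≡ k

  metricDim-squeeze : ∀ k → Dec (ResolvingSetOfSize k) →
    (∀ W → Unique W → Resolving W → k ≤ length W) → ResolvingSetOfSize (suc k) →
    Σ ℕ λ b → IsMetricDim b × k ≤ b × b ≤ suc k
  metricDim-squeeze k (yes size-k) lower _ = k , (size-k , lower) , ≤-refl , n≤1+n k
  metricDim-squeeze k (no ¬size-k) lower size-k+1 = suc k , (size-k+1 , above-k) , n≤1+n k , ≤-refl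
    where
    above-k : ∀ W → Unique W → Resolving W → suc k ≤ length W
    above-k W unique resolves =
      ≤∧≢⇒< (lower W unique resolves) λ k≡len → ¬size-k (W , unique , resolves , sym k≡len)

module FiniteGraph {V : Set} (Adj : V → V → Set) (_≟_ : DecidableEquality V)
  (adj? : ∀ u v → Dec (Adj u v)) (vertices : List V) (∈-vertices : ∀ v → v ∈ vertices)
  (connected : ∀ u w → ∃ λ n → GraphNotions.Walk Adj u w n) where

  open GraphNotions Adj
  open GraphFacts Adj

  walk? : ∀ u w n → Dec (Walk u w n)
  walk? u w zero with u ≟ w
  ... | yes refl = yes here
  ... | no u≢w = no λ { here → u≢w refl }
  walk? u w (suc n) with any? (λ v → adj? u v ×-dec walk? v w n) vertices
  ... | yes found with find found
  ...   | v , _ , (uv , vw) = yes (step uv vw)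
  walk? u w (suc n) | no none = no λ { (step {v = v} uv vw) → none (lose (∈-vertices v) (uv , vw)) }

  distance : ∀ u w → ∃ (IsDist u w)
  distance u w = least-satisfying (Walk u w) (walk? u w) (proj₂ (connected u w))

  dist : V → V → ℕ
  dist u w = proj₁ (distance u w)

  ResolvingByEnumeration : List V → Set
  ResolvingByEnumeration W =
    All (λ u → All (λ v → u ≡ v ⊎ Any (λ w → dist u w ≢ dist v w) W) vertices) vertices

  resolvingByEnumeration? : ∀ W → Dec (ResolvingByEnumeration W)
  resolvingByEnumeration? W = all? (λ u → all? (separated? u) vertices) vertices
    where
    separated? : ∀ u v → Dec (u ≡ v ⊎ Any (λ w → dist u w ≢ dist v w) W)
    separated? u v with u ≟ v
    ... | yes u≡v = yes (inj₁ u≡v)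
    ... | no u≢v with any? (λ w → ¬? (dist u w ℕ.≟ dist v w)) W
    ...   | yes sep = yes (inj₂ sep)
    ...   | no ¬sep = no λ { (inj₁ u≡v) → u≢v u≡v ; (inj₂ sep) → ¬sep sep }

  byEnumeration⇒Resolving : ∀ W → ResolvingByEnumeration W → Resolving W
  byEnumeration⇒Resolving W r u v u≢v with lookup (lookup r (∈-vertices u)) (∈-vertices v)
  ... | inj₁ u≡v = contradiction u≡v u≢v
  ... | inj₂ sep with find sep
  ...   | w , w∈W , d≢ = w , w∈W , dist u w , dist v w , proj₂ (distance u w) , proj₂ (distance v w) , d≢

  Resolving⇒byEnumeration : ∀ W → Resolving W → ResolvingByEnumeration W
  Resolving⇒byEnumeration W r = tabulate λ {u} _ → tabulate λ {v} _ → separated u v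
    where
    separated : ∀ u v → u ≡ v ⊎ Any (λ w → dist u w ≢ dist v w) W
    separated u v with u ≟ v
    ... | yes u≡v = inj₁ u≡v
    ... | no u≢v with r u v u≢v
    ...   | w , w∈W , d₁ , d₂ , u-w , v-w , d₁≢d₂ = inj₂ (lose w∈W λ du≡dv →
      d₁≢d₂ (trans (IsDist-unique u-w (proj₂ (distance u w)))
                   (trans du≡dv (IsDist-unique (proj₂ (distance v w)) v-w))))

  listsOfLength : ℕ → List (List V)
  listsOfLength zero = [] ∷ []
  listsOfLength (suc k) = cartesianProductWith _∷_ vertices (listsOfLength k)

  ∈-listsOfLength : ∀ W → W ∈ listsOfLength (length W)
  ∈-listsOfLength [] = here refl
  ∈-listsOfLength (v ∷ W) = ∈-cartesianProductWith⁺ _∷_ (∈-vertices v) (∈-listsOfLength W)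

  resolvingSetOfSize? : ∀ k → Dec (ResolvingSetOfSize k)
  resolvingSetOfSize? k
    with any? (λ W → UniqueDec.unique? _≟_ W ×-dec (resolvingByEnumeration? W ×-dec length W ℕ.≟ k))
              (listsOfLength k)
  ... | yes found with find found
  ...   | W , _ , (unique , r , len≡k) = yes (W , unique , byEnumeration⇒Resolving W r , len≡k)
  resolvingSetOfSize? k | no none = no λ { (W , unique , r , refl) →
    none (lose (∈-listsOfLength W) (unique , Resolving⇒byEnumeration W r , refl)) }

module ThetaFacts (m : ℕ) (len : Fin m → ℕ) where

  open Theta m len
  open GraphFacts Adj public

  Adj-sym : ∀ {u v} → Adj u v → Adj v u
  Adj-sym (inj₁ e) = inj₂ e
  Adj-sym (inj₂ e) = inj₁ e

  open Undirected Adj-sym public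

  _≟V_ : DecidableEquality ThetaV
  c₁ ≟V c₁ = yes refl
  c₁ ≟V c₂ = no λ ()
  c₁ ≟V inner _ _ = no λ ()
  c₂ ≟V c₁ = no λ ()
  c₂ ≟V c₂ = yes refl
  c₂ ≟V inner _ _ = no λ ()
  inner _ _ ≟V c₁ = no λ ()
  inner _ _ ≟V c₂ = no λ ()
  inner i x ≟V inner i′ x′ with i ≟ᶠ i′
  ... | no i≢i′ = no λ { refl → i≢i′ refl }
  ... | yes refl with x ≟ᶠ x′
  ...   | yes refl = yes refl
  ...   | no x≢x′ = no λ { refl → x≢x′ refl }

  edge? : ∀ u v → Dec (Edge u v)
  edge? c₁ c₁ = no λ ()
  edge? c₁ c₂ with Fin.any? (λ i → len i ≟ 0)
  ... | yes (i , len≡0) = yes (direct i len≡0)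
  ... | no none = no λ { (direct i len≡0) → none (i , len≡0) }
  edge? c₁ (inner i j) with toℕ j ≟ 0
  ... | yes j≡0 = yes (first i j j≡0)
  ... | no j≢0 = no λ { (first _ _ j≡0) → j≢0 j≡0 }
  edge? c₂ _ = no λ ()
  edge? (inner _ _) c₁ = no λ ()
  edge? (inner i j) c₂ with suc (toℕ j) ≟ len i
  ... | yes j-last = yes (last i j j-last)
  ... | no ¬j-last = no λ { (last _ _ j-last) → ¬j-last j-last }
  edge? (inner i j) (inner i′ k) with i ≟ᶠ i′
  ... | no i≢i′ = no λ { (next _ _ _ _) → i≢i′ refl }
  ... | yes refl with suc (toℕ j) ≟ toℕ k
  ...   | yes j→k = yes (next i j k j→k)
  ...   | no ¬j→k = no λ { (next _ _ _ j→k) → ¬j→k j→k }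

  adj? : ∀ u v → Dec (Adj u v)
  adj? u v with edge? u v | edge? v u
  ... | yes uv | _ = yes (inj₁ uv)
  ... | no _ | yes vu = yes (inj₂ vu)
  ... | no ¬uv | no ¬vu = no λ { (inj₁ uv) → ¬uv uv ; (inj₂ vu) → ¬vu vu }

  vertices : List ThetaV
  vertices = c₁ ∷ c₂ ∷ concatMap (λ i → map (inner i) (allFin (len i))) (allFin m)

  ∈-vertices : ∀ v → v ∈ vertices
  ∈-vertices c₁ = here refl
  ∈-vertices c₂ = there (here refl)
  ∈-vertices (inner i j) = there (there (∈-concatMap⁺ _ (lose (∈-allFin i) (∈-map⁺ (inner i) (∈-allFin j)))))

  remaining : ∀ i → Fin (len i) → ℕ
  remaining i j = len i ∸ suc (toℕ j)

  position+remaining : ∀ {i} (j : Fin (len i)) → toℕ j + suc (remaining i j) ≡ len i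
  position+remaining j =
    trans (cong (toℕ j +_) (sym (+-∸-assoc 1 (toℕ<n j)))) (m+[n∸m]≡n (<⇒≤ (toℕ<n j)))

  remaining-first : ∀ {i} (j : Fin (len i)) → toℕ j ≡ 0 → suc (remaining i j) ≡ len i
  remaining-first j j≡0 = trans (cong (_+ suc (remaining _ j)) (sym j≡0)) (position+remaining j)

  remaining-last : ∀ {i} (j : Fin (len i)) → suc (toℕ j) ≡ len i → remaining i j ≡ 0
  remaining-last j j-last = trans (cong (_∸ suc (toℕ j)) (sym j-last)) (n∸n≡0 (suc (toℕ j)))

  remaining-next : ∀ {i} (j k : Fin (len i)) → suc (toℕ j) ≡ toℕ k → remaining i j ≡ suc (remaining i k)
  remaining-next {i} j k j→k = trans (cong (len i ∸_) j→k) (+-∸-assoc 1 (toℕ<n k))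

  walk-along : ∀ i (j : Fin (len i)) n (k : Fin (len i)) → toℕ j + n ≡ toℕ k → Walk (inner i j) (inner i k) n
  walk-along i j zero k j+0≡k =
    subst (λ k → Walk (inner i j) (inner i k) 0) (toℕ-injective (trans (sym (+-identityʳ _)) j+0≡k)) here
  walk-along i j (suc n) k j+n≡k =
    step (inj₁ (next i j j′ (sym (toℕ-fromℕ< j+1<len))))
         (walk-along i j′ n k (trans (cong (_+ n) (toℕ-fromℕ< j+1<len)) (trans (sym (+-suc (toℕ j) n)) j+n≡k)))
    where
    j+1<len : suc (toℕ j) < len i
    j+1<len = ≤-<-trans (≤-trans (s≤s (m≤m+n (toℕ j) n)) (≤-reflexive (trans (sym (+-suc (toℕ j) n)) j+n≡k)))
                        (toℕ<n k)
    j′ : Fin (len i)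
    j′ = fromℕ< j+1<len

  c₁⇝inner : ∀ i (j : Fin (len i)) → Walk c₁ (inner i j) (suc (toℕ j))
  c₁⇝inner i j =
    step (inj₁ (first i j₀ (toℕ-fromℕ< 0<len))) (walk-along i j₀ (toℕ j) j (cong (_+ toℕ j) (toℕ-fromℕ< 0<len)))
    where
    0<len : 0 < len i
    0<len = ≤-<-trans z≤n (toℕ<n j)
    j₀ : Fin (len i)
    j₀ = fromℕ< 0<len

  inner⇝c₂ : ∀ i (j : Fin (len i)) → Walk (inner i j) c₂ (suc (remaining i j))
  inner⇝c₂ i j = subst (Walk _ _) (+-comm (remaining i j) 1)
    (walk-along i j (remaining i j) jₗ (sym (toℕ-fromℕ< last<len)) ++ʷ step (inj₁ (last i jₗ jₗ-last)) here)
    where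
    ends-at-len : suc (toℕ j + remaining i j) ≡ len i
    ends-at-len = trans (sym (+-suc (toℕ j) (remaining i j))) (position+remaining j)
    last<len : toℕ j + remaining i j < len i
    last<len = ≤-reflexive ends-at-len
    jₗ : Fin (len i)
    jₗ = fromℕ< last<len
    jₗ-last : suc (toℕ jₗ) ≡ len i
    jₗ-last = trans (cong suc (toℕ-fromℕ< last<len)) ends-at-len

  c₁⇝c₂ : ∀ i → Walk c₁ c₂ (suc (len i))
  c₁⇝c₂ i with len i ≟ 0
  ... | yes len≡0 = subst (λ l → Walk c₁ c₂ (suc l)) (sym len≡0) (step (inj₁ (direct i len≡0)) here)
  ... | no len≢0 = subst (Walk _ _) (cong suc (position+remaining j₀)) (c₁⇝inner i j₀ ++ʷ inner⇝c₂ i j₀)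
    where
    j₀ : Fin (len i)
    j₀ = fromℕ< (n≢0⇒n>0 len≢0)

  connected : Fin m → ∀ u w → ∃ (Walk u w)
  connected i u w = _ , proj₂ (toward-c₁ u) ++ʷ reverse (proj₂ (toward-c₁ w))
    where
    toward-c₁ : ∀ x → ∃ (Walk x c₁)
    toward-c₁ c₁ = _ , here
    toward-c₁ c₂ = _ , reverse (c₁⇝c₂ i)
    toward-c₁ (inner k j) = _ , reverse (c₁⇝inner k j)

  EdgeLipschitz : (ThetaV → ℕ) → Set
  EdgeLipschitz f = ∀ {u v} → Edge u v → f u ≤ suc (f v) × f v ≤ suc (f u)

  EdgeLipschitz⇒Lipschitz : ∀ {f} → EdgeLipschitz f → Lipschitz f
  EdgeLipschitz⇒Lipschitz L (inj₁ uv) = proj₁ (L uv)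
  EdgeLipschitz⇒Lipschitz L (inj₂ vu) = proj₂ (L vu)

missing-element : ∀ {n} (xs : List (Fin n)) → length xs < n → ∃ λ a → a ∉ xs
missing-element {n} xs len<n = ¬∀⟶∃¬ n (_∈ xs) (λ a → DecMembership._∈?_ _≟ᶠ_ a xs) covers⇒⊥
  where
  covers⇒⊥ : ¬ (∀ a → a ∈ xs)
  covers⇒⊥ covers with pigeonhole len<n (λ a → index (covers a))
  ... | i , j , i<j , same-index = Fin.<⇒≢ i<j (index-injective (setoid _) (covers i) (covers j) same-index)

two-missing-elements : ∀ {n} (xs : List (Fin n)) → suc (length xs) < n → ∃₂ λ a b → a ≢ b × a ∉ xs × b ∉ xs
two-missing-elements xs len<n with missing-element xs (<⇒≤ len<n)
... | a , a∉xs with missing-element (a ∷ xs) len<n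
... | b , b∉a∷xs = a , b , (λ a≡b → b∉a∷xs (here (sym a≡b))) , a∉xs , λ b∈xs → b∉a∷xs (there b∈xs)

transpose-left : ∀ {n} (a b : Fin n) → transpose a b a ≡ b
transpose-left a b rewrite dec-true (a ≟ᶠ a) refl = refl

transpose-fixes : ∀ {n} (a b k : Fin n) → k ≢ a → k ≢ b → transpose a b k ≡ k
transpose-fixes a b k k≢a k≢b rewrite dec-false (k ≟ᶠ a) k≢a | dec-false (k ≟ᶠ b) k≢b = refl

-- The graph Θ(s₁, (1 + s₂)^(m + 1)): only the nonemptiness and equal length of the long paths matter here.
module LowerBound (s₁ s₂ m : ℕ) where

  open Theta (suc (suc m)) (thetaLens s₁ (suc s₂) (suc (suc m)))
  open ThetaFacts (suc (suc m)) (thetaLens s₁ (suc s₂) (suc (suc m)))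

  long-path-of : ThetaV → Maybe (Fin (suc m))
  long-path-of c₁ = nothing
  long-path-of c₂ = nothing
  long-path-of (inner zero _) = nothing
  long-path-of (inner (suc k) _) = just k

  longPathsMet : List ThetaV → List (Fin (suc m))
  longPathsMet = mapMaybe long-path-of

  ∈-longPathsMet : ∀ {W k j} → inner (suc k) j ∈ W → k ∈ longPathsMet W
  ∈-longPathsMet {W} v∈W = mapMaybe⁺ long-path-of W (map⁺ (Any.map (λ { refl → MaybeAny.just refl }) v∈W))

  swap-long-paths : Fin (suc m) → Fin (suc m) → ThetaV → ThetaV
  swap-long-paths a b (inner (suc k) j) = inner (suc (transpose a b k)) j
  swap-long-paths a b v = v

  swap-edge : ∀ a b {u v} → Edge u v → Edge (swap-long-paths a b u) (swap-long-paths a b v)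
  swap-edge a b (direct zero len≡0) = direct zero len≡0
  swap-edge a b (first zero j j≡0) = first zero j j≡0
  swap-edge a b (first (suc k) j j≡0) = first (suc (transpose a b k)) j j≡0
  swap-edge a b (next zero j j′ j→j′) = next zero j j′ j→j′
  swap-edge a b (next (suc k) j j′ j→j′) = next (suc (transpose a b k)) j j′ j→j′
  swap-edge a b (last zero j j-last) = last zero j j-last
  swap-edge a b (last (suc k) j j-last) = last (suc (transpose a b k)) j j-last

  swap-adj : ∀ a b {u v} → Adj u v → Adj (swap-long-paths a b u) (swap-long-paths a b v)
  swap-adj a b (inj₁ uv) = inj₁ (swap-edge a b uv)
  swap-adj a b (inj₂ vu) = inj₂ (swap-edge a b vu)

  swap-swap : ∀ a b v → swap-long-paths b a (swap-long-paths a b v) ≡ v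
  swap-swap a b c₁ = refl
  swap-swap a b c₂ = refl
  swap-swap a b (inner zero j) = refl
  swap-swap a b (inner (suc k) j) = cong (λ k → inner (suc k) j) (transpose-inverse b a)

  two-unmet⇒¬Resolving : ∀ {a b} W → a ≢ b → a ∉ longPathsMet W → b ∉ longPathsMet W → ¬ Resolving W
  two-unmet⇒¬Resolving {a} {b} W a≢b a-unmet b-unmet = fixing⇒¬Resolving fixes moved
    where
    open AdjacencyPreserving (swap-long-paths a b) (swap-long-paths b a) (swap-adj a b) (swap-adj b a) (swap-swap a b)
    moved : inner (suc a) zero ≢ swap-long-paths a b (inner (suc a) zero)
    moved same = a≢b (cong path-index (trans same (cong (λ k → inner (suc k) zero) (transpose-left a b))))
      where
      path-index : ThetaV → Fin (suc m)
      path-index (inner (suc k) _) = k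
      path-index _ = a
    fixes : ∀ {w} → w ∈ W → swap-long-paths a b w ≡ w
    fixes {c₁} _ = refl
    fixes {c₂} _ = refl
    fixes {inner zero _} _ = refl
    fixes {inner (suc k) j} w∈W = cong (λ k → inner (suc k) j)
      (transpose-fixes a b k (λ { refl → a-unmet (∈-longPathsMet w∈W) }) (λ { refl → b-unmet (∈-longPathsMet w∈W) }))

  resolving-size-≥ : ∀ W → Resolving W → m ≤ length W
  resolving-size-≥ W resolves with m ≤? length W
  ... | yes m≤len = m≤len
  ... | no m≰len
    with two-missing-elements (longPathsMet W) (s≤s (≤-<-trans (length-mapMaybe long-path-of W) (≰⇒> m≰len)))
  ...   | a , b , a≢b , a-unmet , b-unmet = contradiction resolves (two-unmet⇒¬Resolving W a≢b a-unmet b-unmet)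

≡⇒≤2+ : ∀ {a b} → a ≡ b → a ≤ 2 + b
≡⇒≤2+ a≡b = ≤-trans (≤-reflexive a≡b) (m≤n+m _ 2)

⊓-suc-shift : ∀ a b → a ⊓ suc b ≤ suc (suc a ⊓ b) × suc a ⊓ b ≤ suc (a ⊓ suc b)
⊓-suc-shift a b = ⊓-mono-≤ (≡⇒≤2+ refl) ≤-refl , ⊓-mono-≤ ≤-refl (≡⇒≤2+ refl)

∣-∣-step : ∀ a b → ∣ a - b ∣ ≤ suc ∣ suc a - b ∣ × ∣ suc a - b ∣ ≤ suc ∣ a - b ∣
∣-∣-step zero zero = z≤n , s≤s z≤n
∣-∣-step (suc a) zero = m≤n⇒m≤1+n (n≤1+n (suc a)) , ≤-refl
∣-∣-step zero (suc b) = ≤-refl , m≤n⇒m≤1+n (n≤1+n b)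
∣-∣-step (suc a) (suc b) = ∣-∣-step a b

∣-∣≤ : ∀ a b c → a ≤ b + c → b ≤ a + c → ∣ a - b ∣ ≤ c
∣-∣≤ zero b c _ b≤c = b≤c
∣-∣≤ (suc a) zero c a≤c _ = a≤c
∣-∣≤ (suc a) (suc b) c (s≤s a≤b+c) (s≤s b≤a+c) = ∣-∣≤ a b c a≤b+c b≤a+c

∣-∣≤+ : ∀ a b → ∣ a - b ∣ ≤ a + b
∣-∣≤+ a b = ≤-trans (∣m-n∣≤m⊔n a b) (m⊔n≤m+n a b)

⊓+⊓-glb : ∀ {x a b c d} → x ≤ a + c → x ≤ a + d → x ≤ b + c → x ≤ b + d → x ≤ a ⊓ b + c ⊓ d
⊓+⊓-glb {a = a} {b} {c} {d} ac ad bc bd = subst (_ ≤_) (sym expand) (⊓-glb (⊓-glb ac ad) (⊓-glb bc bd))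
  where
  expand : a ⊓ b + c ⊓ d ≡ ((a + c) ⊓ (a + d)) ⊓ ((b + c) ⊓ (b + d))
  expand = trans (+-distribʳ-⊓ (c ⊓ d) a b) (cong₂ _⊓_ (+-distribˡ-⊓ a c d) (+-distribˡ-⊓ b c d))

⊓-direct : ∀ a b δ → a ⊓ (b + δ) ≡ a ⊎ b ⊓ (a + δ) ≡ b
⊓-direct a b δ with a ≤? b + δ
... | yes a≤b+δ = inj₁ (m≤n⇒m⊓n≡m a≤b+δ)
... | no a≰b+δ = inj₂ (m≤n⇒m⊓n≡m (≤-trans (≤-trans (m≤m+n b δ) (<⇒≤ (≰⇒> a≰b+δ))) (m≤m+n a δ)))

private
  min-pair-mixed : ∀ {δ a b a′ b′} → 0 < δ → a + b ≡ a′ + b′ →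
                   a ⊓ (b + δ) ≡ a → b′ ⊓ (a′ + δ) ≡ b′ →
                   a ⊓ (b + δ) ≡ a′ ⊓ (b′ + δ) → b ⊓ (a + δ) ≡ b′ ⊓ (a′ + δ) → a ≡ a′
  min-pair-mixed {δ} {a} {b} {a′} {b′} δ>0 sums first-direct second-direct′ first≡ second≡
    with a′ ≤? b′ + δ | b ≤? a + δ
  ... | yes a′≤b′+δ | _ = trans (sym first-direct) (trans first≡ (m≤n⇒m⊓n≡m a′≤b′+δ))
  ... | no _ | yes b≤a+δ = +-cancelʳ-≡ b a a′ (trans sums (cong (a′ +_) (sym b≡b′)))
    where
    b≡b′ : b ≡ b′
    b≡b′ = trans (sym (m≤n⇒m⊓n≡m b≤a+δ)) (trans second≡ second-direct′)
  ... | no a′≰b′+δ | no b≰a+δ = contradiction (trans a≡b′+δ (cong (_+ δ) b′≡a+δ)) (<⇒≢ a<a+δ+δ)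
    where
    a≡b′+δ : a ≡ b′ + δ
    a≡b′+δ = trans (sym first-direct) (trans first≡ (m≥n⇒m⊓n≡n (<⇒≤ (≰⇒> a′≰b′+δ))))
    b′≡a+δ : b′ ≡ a + δ
    b′≡a+δ = trans (sym second-direct′) (trans (sym second≡) (m≥n⇒m⊓n≡n (<⇒≤ (≰⇒> b≰a+δ))))
    a<a+δ+δ : a < a + δ + δ
    a<a+δ+δ = ≤-trans (m<m+n a δ>0) (m≤m+n (a + δ) δ)

-- For a vertex of a long path, a and b are its distances to c₁ and c₂ along that path (so a + b is fixed) and
-- the two minima its distances to c₁ and c₂ in G, going round through the other centre costing δ extra.
min-pair-injective : ∀ {δ a b a′ b′} → 0 < δ → a + b ≡ a′ + b′ →
                     a ⊓ (b + δ) ≡ a′ ⊓ (b′ + δ) → b ⊓ (a + δ) ≡ b′ ⊓ (a′ + δ) → a ≡ a′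
min-pair-injective {δ} {a} {b} {a′} {b′} δ>0 sums first≡ second≡ with ⊓-direct a b δ | ⊓-direct a′ b′ δ
... | inj₁ first-direct | inj₁ first-direct′ = trans (sym first-direct) (trans first≡ first-direct′)
... | inj₂ second-direct | inj₂ second-direct′ = +-cancelʳ-≡ b a a′ (trans sums (cong (a′ +_) (sym b≡b′)))
  where
  b≡b′ : b ≡ b′
  b≡b′ = trans (sym second-direct) (trans second≡ second-direct′)
... | inj₁ first-direct | inj₂ second-direct′ = min-pair-mixed δ>0 sums first-direct second-direct′ first≡ second≡
... | inj₂ second-direct | inj₁ first-direct′ =
  sym (min-pair-mixed δ>0 (sym sums) first-direct′ second-direct (sym first≡) (sym second≡))

module UpperBound (s₁ e n : ℕ) where

  s₂ : ℕ
  s₂ = suc (s₁ + e)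

  m : ℕ
  m = suc (suc (suc (suc n)))

  len : Fin m → ℕ
  len = thetaLens s₁ s₂ m

  open Theta m len
  open ThetaFacts m len

  δ : ℕ
  δ = suc s₁

  d₁ : ThetaV → ℕ
  d₁ c₁ = 0
  d₁ c₂ = δ
  d₁ (inner zero j) = suc (toℕ j)
  d₁ (inner (suc k) j) = suc (toℕ j) ⊓ (suc (remaining (suc k) j) + δ)

  d₂ : ThetaV → ℕ
  d₂ c₁ = δ
  d₂ c₂ = 0
  d₂ (inner zero j) = suc (remaining zero j)
  d₂ (inner (suc k) j) = suc (remaining (suc k) j) ⊓ (suc (toℕ j) + δ)

  d₁-Lipschitz : EdgeLipschitz d₁
  d₁-Lipschitz (direct zero s₁≡0) = z≤n , s≤s (≤-reflexive s₁≡0)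
  d₁-Lipschitz (first zero j j≡0) = z≤n , ≤-reflexive (cong suc j≡0)
  d₁-Lipschitz (first (suc k) j j≡0) = z≤n , ≤-trans (m⊓n≤m _ _) (≤-reflexive (cong suc j≡0))
  d₁-Lipschitz (next zero j k j→k) = ≡⇒≤2+ j→k , ≤-reflexive (cong suc (sym j→k))
  d₁-Lipschitz (next (suc i) j k j→k) rewrite remaining-next {suc i} j k j→k =
    ⊓-mono-≤ (≡⇒≤2+ j→k) ≤-refl , ⊓-mono-≤ (≤-reflexive (cong suc (sym j→k))) (≡⇒≤2+ refl)
  d₁-Lipschitz (last zero j j-last) = ≡⇒≤2+ j-last , ≤-reflexive (cong suc (sym j-last))
  d₁-Lipschitz (last (suc k) j j-last) rewrite remaining-last {suc k} j j-last =
    m⊓n≤n (suc (toℕ j)) _ ,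
    m≤n⇒m≤1+n (⊓-glb (≤-trans (s≤s (m≤m+n s₁ e)) (≤-reflexive (sym j-last))) (n≤1+n _))

  d₂-Lipschitz : EdgeLipschitz d₂
  d₂-Lipschitz (direct zero s₁≡0) = s≤s (≤-reflexive s₁≡0) , z≤n
  d₂-Lipschitz (first zero j j≡0) =
    ≤-reflexive (cong suc (sym (remaining-first j j≡0))) , ≡⇒≤2+ (remaining-first j j≡0)
  d₂-Lipschitz (first (suc k) j j≡0) =
    m≤n⇒m≤1+n (⊓-glb (≤-trans (s≤s (m≤m+n s₁ e)) (≤-reflexive (sym (remaining-first {suc k} j j≡0))))
                     (m≤n+m δ (suc (toℕ j)))) ,
    ≤-trans (m⊓n≤n _ _) (≤-reflexive (cong (λ x → suc (x + δ)) j≡0))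
  d₂-Lipschitz (next zero j k j→k) rewrite remaining-next {zero} j k j→k = ≤-refl , ≡⇒≤2+ refl
  d₂-Lipschitz (next (suc i) j k j→k) rewrite remaining-next {suc i} j k j→k =
    ⊓-mono-≤ ≤-refl (≡⇒≤2+ (cong (_+ δ) j→k)) ,
    ⊓-mono-≤ (≡⇒≤2+ refl) (≤-reflexive (cong (λ x → suc (x + δ)) (sym j→k)))
  d₂-Lipschitz (last zero j j-last) rewrite remaining-last {zero} j j-last = s≤s z≤n , z≤n
  d₂-Lipschitz (last (suc k) j j-last) rewrite remaining-last {suc k} j j-last = s≤s z≤n , z≤n

  ⇝c₁ : ∀ x → Walk x c₁ (d₁ x)
  ⇝c₁ c₁ = here
  ⇝c₁ c₂ = reverse (c₁⇝c₂ zero)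
  ⇝c₁ (inner zero j) = reverse (c₁⇝inner zero j)
  ⇝c₁ (inner (suc k) j) = min-walk (reverse (c₁⇝inner (suc k) j)) (inner⇝c₂ (suc k) j ++ʷ reverse (c₁⇝c₂ zero))

  ⇝c₂ : ∀ x → Walk x c₂ (d₂ x)
  ⇝c₂ c₁ = c₁⇝c₂ zero
  ⇝c₂ c₂ = here
  ⇝c₂ (inner zero j) = inner⇝c₂ zero j
  ⇝c₂ (inner (suc k) j) = min-walk (inner⇝c₂ (suc k) j) (reverse (c₁⇝inner (suc k) j) ++ʷ c₁⇝c₂ zero)

  d₂-IsDist : ∀ x → IsDist x c₂ (d₂ x)
  d₂-IsDist x = potential⇒IsDist (EdgeLipschitz⇒Lipschitz d₂-Lipschitz) refl (⇝c₂ x)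

  t : ℕ
  t = ⌊ e ∸ 1 /2⌋

  t+t≤e∸1 : t + t ≤ e ∸ 1
  t+t≤e∸1 = ≤-trans (+-monoʳ-≤ t (⌊n/2⌋≤⌈n/2⌉ (e ∸ 1))) (≤-reflexive (⌊n/2⌋+⌈n/2⌉≡n (e ∸ 1)))

  e≤2+t+t : e ≤ 2 + (t + t)
  e≤2+t+t = begin
    e                       ≤⟨ m≤n+m∸n e 1 ⟩
    suc (e ∸ 1)             ≡⟨ cong suc (sym (⌊n/2⌋+⌈n/2⌉≡n (e ∸ 1))) ⟩
    suc (t + ⌈ e ∸ 1 /2⌉)   ≤⟨ s≤s (+-monoʳ-≤ t (⌊n/2⌋-mono (n≤1+n (suc (e ∸ 1))))) ⟩
    suc (t + suc t)         ≡⟨ cong suc (+-suc t t) ⟩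
    2 + (t + t)             ∎
    where open ≤-Reasoning

  t<s₂ : t < s₂
  t<s₂ = s≤s (≤-trans (≤-trans (m≤m+n t t) (≤-trans t+t≤e∸1 (m∸n≤m e 1))) (m≤n+m e s₁))

  t-position : Fin s₂
  t-position = fromℕ< t<s₂

  rest : Fin s₂ → ℕ
  rest j = s₂ ∸ suc (toℕ j)

  position+rest : ∀ (j : Fin s₂) → toℕ j + rest j ≡ s₁ + e
  position+rest j = suc-injective (trans (sym (+-suc (toℕ j) (rest j))) (position+remaining {suc zero} j))

  t+rest≡s₁+e : t + rest t-position ≡ s₁ + e
  t+rest≡s₁+e = trans (cong (_+ rest t-position) (sym (toℕ-fromℕ< t<s₂))) (position+rest t-position)

  landmark : Fin (suc (suc n)) → ThetaV
  landmark k = inner (suc (suc k)) t-position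

  d₂-landmark : ℕ
  d₂-landmark = suc (rest t-position) ⊓ (suc t + δ)

  d₂-landmark-e≡0 : e ≡ 0 → t ≡ 0 × d₂-landmark ≡ δ
  d₂-landmark-e≡0 refl = refl , trans (cong (λ r → suc r ⊓ suc δ) rest≡s₁) (m≤n⇒m⊓n≡m (n≤1+n δ))
    where
    rest≡s₁ : rest t-position ≡ s₁
    rest≡s₁ = trans t+rest≡s₁+e (+-identityʳ s₁)

  d₂-landmark-e≢0 : e ≢ 0 → d₂-landmark ≡ suc t + δ
  d₂-landmark-e≢0 e≢0 = m≥n⇒m⊓n≡n (s≤s (+-cancelˡ-≤ t _ _ (begin
    t + (t + suc s₁)    ≡⟨ shuffle t s₁ ⟩
    s₁ + suc (t + t)    ≤⟨ +-monoʳ-≤ s₁ (≤-trans (s≤s t+t≤e∸1) (≤-reflexive (suc-pred e ⦃ ≢-nonZero e≢0 ⦄))) ⟩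
    s₁ + e              ≡⟨ sym t+rest≡s₁+e ⟩
    t + rest t-position ∎)))
    where
    open ≤-Reasoning
    shuffle : ∀ a b → a + (a + suc b) ≡ b + suc (a + a)
    shuffle = solve-∀

  dₗ-off-path : ThetaV → ℕ
  dₗ-off-path x = (d₁ x + suc t) ⊓ (d₂ x + d₂-landmark)

  dₗ-on-path : Fin s₂ → ℕ
  dₗ-on-path j = ∣ toℕ j - t ∣ ⊓ (suc (rest j) + δ + suc t)

  dₗ : Fin (suc (suc n)) → ThetaV → ℕ
  dₗ k (inner (suc (suc k′)) j) with k′ ≟ᶠ k
  ... | yes _ = dₗ-on-path j
  ... | no _ = dₗ-off-path (inner (suc (suc k′)) j)
  dₗ k x = dₗ-off-path x

  dₗ-off-path-Lipschitz : EdgeLipschitz dₗ-off-path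
  dₗ-off-path-Lipschitz uv =
    ⊓-mono-≤ (+-monoˡ-≤ (suc t) (proj₁ (d₁-Lipschitz uv))) (+-monoˡ-≤ d₂-landmark (proj₁ (d₂-Lipschitz uv))) ,
    ⊓-mono-≤ (+-monoˡ-≤ (suc t) (proj₂ (d₁-Lipschitz uv))) (+-monoˡ-≤ d₂-landmark (proj₂ (d₂-Lipschitz uv)))

  dₗ-on-path-next : ∀ (j j′ : Fin s₂) → suc (toℕ j) ≡ toℕ j′ →
                    dₗ-on-path j ≤ suc (dₗ-on-path j′) × dₗ-on-path j′ ≤ suc (dₗ-on-path j)
  dₗ-on-path-next j j′ j→j′ rewrite remaining-next {suc zero} j j′ j→j′ | sym j→j′ =
    ⊓-mono-≤ (proj₁ (∣-∣-step (toℕ j) t)) ≤-refl , ⊓-mono-≤ (proj₂ (∣-∣-step (toℕ j) t)) (≡⇒≤2+ refl)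

  t≤d₂-landmark : t ≤ d₂-landmark
  t≤d₂-landmark = ⊓-glb (m≤n⇒m≤1+n t≤rest) (m≤n⇒m≤1+n (m≤m+n t δ))
    where
    t≤rest : t ≤ rest t-position
    t≤rest = +-cancelˡ-≤ t t _
      (≤-trans (≤-trans t+t≤e∸1 (≤-trans (m∸n≤m e 1) (m≤n+m e s₁))) (≤-reflexive (sym t+rest≡s₁+e)))

  dₗ-on-path-first : ∀ (j : Fin s₂) → toℕ j ≡ 0 →
                     dₗ-off-path c₁ ≤ suc (dₗ-on-path j) × dₗ-on-path j ≤ suc (dₗ-off-path c₁)
  dₗ-on-path-first j j≡0 rewrite j≡0 =
    ≤-trans (m⊓n≤m _ _) (s≤s (⊓-glb ≤-refl (≤-trans (n≤1+n t) (m≤n+m (suc t) (s₂ + δ))))) ,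
    ≤-trans (m⊓n≤m _ _) (m≤n⇒m≤1+n (⊓-glb (n≤1+n t) (≤-trans t≤d₂-landmark (m≤n+m d₂-landmark δ))))

  dₗ-on-path-last : ∀ (j : Fin s₂) → suc (toℕ j) ≡ s₂ →
                    dₗ-on-path j ≤ suc (dₗ-off-path c₂) × dₗ-off-path c₂ ≤ suc (dₗ-on-path j)
  dₗ-on-path-last j j-last =
    subst₂ (λ x y → x ≤ suc y × y ≤ suc x) (sym on-path≡) (sym off-path≡)
           (⊓-suc-shift (rest t-position) (suc t + δ))
    where
    rest≡0 : rest j ≡ 0
    rest≡0 = remaining-last {suc zero} j j-last
    position≡ : toℕ j ≡ t + rest t-position
    position≡ = begin
      toℕ j              ≡⟨ sym (+-identityʳ (toℕ j)) ⟩
      toℕ j + 0          ≡⟨ cong (toℕ j +_) (sym rest≡0) ⟩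
      toℕ j + rest j     ≡⟨ position+rest j ⟩
      s₁ + e             ≡⟨ sym t+rest≡s₁+e ⟩
      t + rest t-position ∎
      where open ≡-Reasoning
    on-path≡ : dₗ-on-path j ≡ rest t-position ⊓ suc (suc t + δ)
    on-path≡ = cong₂ _⊓_
      (trans (cong (λ x → ∣ x - t ∣) position≡) (trans (∣-∣-comm (t + rest t-position) t) (∣m-m+n∣≡n t _)))
      (trans (cong (λ r → suc r + δ + suc t) rest≡0) (cong suc (+-comm δ (suc t))))
    off-path≡ : dₗ-off-path c₂ ≡ suc (rest t-position) ⊓ (suc t + δ)
    off-path≡ = trans (cong (_⊓ d₂-landmark) (+-comm δ (suc t))) (m≥n⇒m⊓n≡n (m⊓n≤n _ _))

  dₗ-Lipschitz : ∀ k → EdgeLipschitz (dₗ k)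
  dₗ-Lipschitz k (direct i s₁≡0) = dₗ-off-path-Lipschitz (direct i s₁≡0)
  dₗ-Lipschitz k (first zero j j≡0) = dₗ-off-path-Lipschitz (first zero j j≡0)
  dₗ-Lipschitz k (first (suc zero) j j≡0) = dₗ-off-path-Lipschitz (first (suc zero) j j≡0)
  dₗ-Lipschitz k (first (suc (suc k′)) j j≡0) with k′ ≟ᶠ k
  ... | yes _ = dₗ-on-path-first j j≡0
  ... | no _ = dₗ-off-path-Lipschitz (first (suc (suc k′)) j j≡0)
  dₗ-Lipschitz k (next zero j j′ j→j′) = dₗ-off-path-Lipschitz (next zero j j′ j→j′)
  dₗ-Lipschitz k (next (suc zero) j j′ j→j′) = dₗ-off-path-Lipschitz (next (suc zero) j j′ j→j′)
  dₗ-Lipschitz k (next (suc (suc k′)) j j′ j→j′) with k′ ≟ᶠ k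
  ... | yes _ = dₗ-on-path-next j j′ j→j′
  ... | no _ = dₗ-off-path-Lipschitz (next (suc (suc k′)) j j′ j→j′)
  dₗ-Lipschitz k (last zero j j-last) = dₗ-off-path-Lipschitz (last zero j j-last)
  dₗ-Lipschitz k (last (suc zero) j j-last) = dₗ-off-path-Lipschitz (last (suc zero) j j-last)
  dₗ-Lipschitz k (last (suc (suc k′)) j j-last) with k′ ≟ᶠ k
  ... | yes _ = dₗ-on-path-last j j-last
  ... | no _ = dₗ-off-path-Lipschitz (last (suc (suc k′)) j j-last)

  dₗ-on-path≡ : ∀ k j → dₗ k (inner (suc (suc k)) j) ≡ dₗ-on-path j
  dₗ-on-path≡ k j with k ≟ᶠ k
  ... | yes _ = refl
  ... | no k≢k = contradiction refl k≢k

  dₗ-other-path≡ : ∀ k k′ j → k′ ≢ k → dₗ k (inner (suc (suc k′)) j) ≡ dₗ-off-path (inner (suc (suc k′)) j)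
  dₗ-other-path≡ k k′ j k′≢k with k′ ≟ᶠ k
  ... | yes k′≡k = contradiction k′≡k k′≢k
  ... | no _ = refl

  dₗ-landmark : ∀ k → dₗ k (landmark k) ≡ 0
  dₗ-landmark k rewrite dₗ-on-path≡ k t-position | toℕ-fromℕ< t<s₂ | ∣n-n∣≡0 t = refl

  c₂⇝landmark : ∀ k → Walk c₂ (landmark k) d₂-landmark
  c₂⇝landmark k = min-walk (reverse (inner⇝c₂ (suc (suc k)) t-position))
    (subst (Walk _ _) (trans (+-comm δ _) (cong (λ x → suc x + δ) (toℕ-fromℕ< t<s₂)))
      (reverse (c₁⇝c₂ zero) ++ʷ c₁⇝inner (suc (suc k)) t-position))

  ⇝landmark-off-path : ∀ k x → Walk x (landmark k) (dₗ-off-path x)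
  ⇝landmark-off-path k x = min-walk
    (subst (Walk _ _) (cong (λ y → d₁ x + suc y) (toℕ-fromℕ< t<s₂))
           (⇝c₁ x ++ʷ c₁⇝inner (suc (suc k)) t-position))
    (⇝c₂ x ++ʷ c₂⇝landmark k)

  ⇝landmark-on-path : ∀ k (j : Fin s₂) → Walk (inner (suc (suc k)) j) (landmark k) (dₗ-on-path j)
  ⇝landmark-on-path k j = min-walk straight
    (subst (Walk _ _) length≡ (inner⇝c₂ (suc (suc k)) j ++ʷ (reverse (c₁⇝c₂ zero) ++ʷ c₁⇝inner (suc (suc k)) t-position)))
    where
    length≡ : suc (rest j) + (δ + suc (toℕ t-position)) ≡ suc (rest j) + δ + suc t
    length≡ = sym (trans (+-assoc (suc (rest j)) δ (suc t))
                         (cong (λ y → suc (rest j) + (δ + suc y)) (sym (toℕ-fromℕ< t<s₂))))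
    straight : Walk (inner (suc (suc k)) j) (landmark k) ∣ toℕ j - t ∣
    straight with toℕ j ≤? t
    ... | yes j≤t = subst (Walk _ _) (sym (m≤n⇒∣m-n∣≡n∸m j≤t))
          (walk-along (suc (suc k)) j (t ∸ toℕ j) t-position (trans (m+[n∸m]≡n j≤t) (sym (toℕ-fromℕ< t<s₂))))
    ... | no j≰t = subst (Walk _ _) (sym (m≤n⇒∣n-m∣≡n∸m t≤j))
          (reverse (walk-along (suc (suc k)) t-position (toℕ j ∸ t) j
                     (trans (cong (_+ (toℕ j ∸ t)) (toℕ-fromℕ< t<s₂)) (m+[n∸m]≡n t≤j))))
      where
      t≤j : t ≤ toℕ j
      t≤j = <⇒≤ (≰⇒> j≰t)

  ⇝landmark : ∀ k x → Walk x (landmark k) (dₗ k x)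
  ⇝landmark k (inner (suc (suc k′)) j) with k′ ≟ᶠ k
  ... | yes refl = ⇝landmark-on-path k j
  ... | no _ = ⇝landmark-off-path k (inner (suc (suc k′)) j)
  ⇝landmark k c₁ = ⇝landmark-off-path k c₁
  ⇝landmark k c₂ = ⇝landmark-off-path k c₂
  ⇝landmark k (inner zero j) = ⇝landmark-off-path k (inner zero j)
  ⇝landmark k (inner (suc zero) j) = ⇝landmark-off-path k (inner (suc zero) j)

  dₗ-IsDist : ∀ k x → IsDist x (landmark k) (dₗ k x)
  dₗ-IsDist k x = potential⇒IsDist (EdgeLipschitz⇒Lipschitz (dₗ-Lipschitz k)) (dₗ-landmark k) (⇝landmark k x)

  d₂≡0⇒c₂ : ∀ {x} → d₂ x ≡ 0 → x ≡ c₂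
  d₂≡0⇒c₂ {c₁} ()
  d₂≡0⇒c₂ {c₂} _ = refl
  d₂≡0⇒c₂ {inner zero _} ()
  d₂≡0⇒c₂ {inner (suc _) _} ()

  d₁≤d₂+δ : ∀ x → d₁ x ≤ d₂ x + δ
  d₁≤d₂+δ x = Lipschitz⇒≤walk (EdgeLipschitz⇒Lipschitz d₁-Lipschitz) (⇝c₂ x)

  -- Needed for e = 0 only, where d(c₂, landmark) is δ rather than t + 1 + δ.
  d₁<d₂+δ : e ≡ 0 → ∀ {x} → x ≢ c₂ → d₁ x < d₂ x + δ
  d₁<d₂+δ e≡0 {c₁} _ = s≤s z≤n
  d₁<d₂+δ e≡0 {c₂} c₂≢c₂ = contradiction refl c₂≢c₂
  d₁<d₂+δ e≡0 {inner zero j} _ = s≤s (≤-trans (toℕ<n j) (≤-trans (n≤1+n s₁) (m≤n+m δ _)))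
  d₁<d₂+δ e≡0 {inner (suc k) j} _ = begin-strict
    d₁ (inner (suc k) j)                        ≤⟨ m⊓n≤m _ _ ⟩
    suc (toℕ j)                                 <⟨ ⊓-glb before-c₂ via-c₁ ⟩
    (suc (rest j) + δ) ⊓ (suc (toℕ j) + δ + δ)  ≡⟨ sym (+-distribʳ-⊓ δ (suc (rest j)) (suc (toℕ j) + δ)) ⟩
    d₂ (inner (suc k) j) + δ                    ∎
    where
    open ≤-Reasoning
    j≤s₁ : toℕ j ≤ s₁
    j≤s₁ = ≤-trans (m≤m+n (toℕ j) (rest j))
                   (≤-reflexive (trans (position+rest j) (trans (cong (s₁ +_) e≡0) (+-identityʳ s₁))))
    before-c₂ : 2 + toℕ j ≤ suc (rest j) + δ
    before-c₂ = s≤s (≤-trans (s≤s j≤s₁) (m≤n+m δ (rest j)))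
    via-c₁ : 2 + toℕ j ≤ suc (toℕ j) + δ + δ
    via-c₁ = ≤-trans (≤-reflexive (+-comm 1 (suc (toℕ j))))
                     (≤-trans (+-monoʳ-≤ (suc (toℕ j)) (s≤s z≤n)) (m≤m+n _ δ))

  dₗ-off-path-via-c₁ : ∀ {x} → x ≢ c₂ → dₗ-off-path x ≡ d₁ x + suc t
  dₗ-off-path-via-c₁ {x} x≢c₂ = m≤n⇒m⊓n≡m via-c₁-shorter
    where
    via-c₁-shorter : d₁ x + suc t ≤ d₂ x + d₂-landmark
    via-c₁-shorter with e ≟ 0
    ... | yes e≡0 with d₂-landmark-e≡0 e≡0
    ...   | t≡0 , d₂-landmark≡δ = begin
      d₁ x + suc t       ≡⟨ trans (cong (λ y → d₁ x + suc y) t≡0) (+-comm (d₁ x) 1) ⟩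
      suc (d₁ x)         ≤⟨ d₁<d₂+δ e≡0 x≢c₂ ⟩
      d₂ x + δ           ≡⟨ cong (d₂ x +_) (sym d₂-landmark≡δ) ⟩
      d₂ x + d₂-landmark ∎
      where open ≤-Reasoning
    via-c₁-shorter | no e≢0 = begin
      d₁ x + suc t         ≤⟨ +-monoˡ-≤ (suc t) (d₁≤d₂+δ x) ⟩
      d₂ x + δ + suc t     ≡⟨ trans (+-assoc (d₂ x) δ (suc t)) (cong (d₂ x +_) (+-comm δ (suc t))) ⟩
      d₂ x + (suc t + δ)   ≡⟨ cong (d₂ x +_) (sym (d₂-landmark-e≢0 e≢0)) ⟩
      d₂ x + d₂-landmark   ∎
      where open ≤-Reasoning

  -- Here e ≤ 2 + 2t is used: from the far end of the path the route through c₂ and c₁ must not be shorter.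
  dₗ-on-path<via-c₁ : ∀ k (j : Fin s₂) → dₗ-on-path j < d₁ (inner (suc (suc k)) j) + suc t
  dₗ-on-path<via-c₁ k j = begin-strict
    dₗ-on-path j                                              ≤⟨ m⊓n≤m _ _ ⟩
    ∣ toℕ j - t ∣                                             <⟨ ⊓-glb before-c₁ before-c₂ ⟩
    (suc (toℕ j) + suc t) ⊓ (suc (rest j) + δ + suc t)        ≡⟨ sym (+-distribʳ-⊓ (suc t) (suc (toℕ j)) (suc (rest j) + δ)) ⟩
    d₁ (inner (suc (suc k)) j) + suc t                        ∎
    where
    open ≤-Reasoning
    before-c₁ : ∣ toℕ j - t ∣ < suc (toℕ j) + suc t
    before-c₁ = s≤s (≤-trans (∣-∣≤+ (toℕ j) t) (+-monoʳ-≤ (toℕ j) (n≤1+n t)))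
    j≤t+rest+δ+1+t : toℕ j ≤ t + (rest j + δ + suc t)
    j≤t+rest+δ+1+t = begin
      toℕ j                          ≤⟨ m≤m+n (toℕ j) (rest j) ⟩
      toℕ j + rest j                 ≡⟨ position+rest j ⟩
      s₁ + e                         ≤⟨ +-monoʳ-≤ s₁ e≤2+t+t ⟩
      s₁ + (2 + (t + t))             ≡⟨ shuffle t s₁ ⟩
      t + (0 + δ + suc t)            ≤⟨ +-monoʳ-≤ t (+-monoˡ-≤ (suc t) (+-monoˡ-≤ δ (z≤n {rest j}))) ⟩
      t + (rest j + δ + suc t)       ∎
      where
      shuffle : ∀ a b → b + (2 + (a + a)) ≡ a + (0 + suc b + suc a)
      shuffle = solve-∀
    before-c₂ : ∣ toℕ j - t ∣ < suc (rest j) + δ + suc t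
    before-c₂ = s≤s (∣-∣≤ (toℕ j) t _ j≤t+rest+δ+1+t
                          (≤-trans (≤-trans (n≤1+n t) (m≤n+m (suc t) (rest j + δ))) (m≤n+m _ (toℕ j))))

  data OnShortPath : ThetaV → Set where
    centre₁ : OnShortPath c₁
    centre₂ : OnShortPath c₂
    short : ∀ j → OnShortPath (inner zero j)

  data OffLandmarkPaths : ThetaV → Set where
    on-short : ∀ {x} → OnShortPath x → OffLandmarkPaths x
    on-free : ∀ j → OffLandmarkPaths (inner (suc zero) j)

  data View : ThetaV → Set where
    on-landmark-path : ∀ k j → View (inner (suc (suc k)) j)
    off-landmark-paths : ∀ {x} → OffLandmarkPaths x → View x

  view : ∀ x → View x
  view c₁ = off-landmark-paths (on-short centre₁)
  view c₂ = off-landmark-paths (on-short centre₂)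
  view (inner zero j) = off-landmark-paths (on-short (short j))
  view (inner (suc zero) j) = off-landmark-paths (on-free j)
  view (inner (suc (suc k)) j) = on-landmark-path k j

  d₁-injective-on-short : ∀ {x y} → OnShortPath x → OnShortPath y → d₁ x ≡ d₁ y → x ≡ y
  d₁-injective-on-short centre₁ centre₁ _ = refl
  d₁-injective-on-short centre₂ centre₂ _ = refl
  d₁-injective-on-short (short j) (short j′) d₁≡ = cong (inner zero) (toℕ-injective (suc-injective d₁≡))
  d₁-injective-on-short (short j) centre₂ d₁≡ = contradiction d₁≡ (<⇒≢ (s≤s (toℕ<n j)))
  d₁-injective-on-short centre₂ (short j) d₁≡ = contradiction (sym d₁≡) (<⇒≢ (s≤s (toℕ<n j)))

  d₁+d₂≡δ : ∀ {x} → OnShortPath x → d₁ x + d₂ x ≡ δ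
  d₁+d₂≡δ centre₁ = refl
  d₁+d₂≡δ centre₂ = +-identityʳ δ
  d₁+d₂≡δ (short j) = cong suc (position+remaining j)

  δ<d₁+d₂ : ∀ k j → δ < d₁ (inner (suc k) j) + d₂ (inner (suc k) j)
  δ<d₁+d₂ k j = ⊓+⊓-glb {suc δ} {suc (toℕ j)} {suc (rest j) + δ} {suc (rest j)} {suc (toℕ j) + δ}
    (≤-trans (s≤s (s≤s (m≤m+n s₁ e))) (≤-reflexive (cong suc (sym (position+remaining {suc k} j)))))
    (s≤s (≤-trans (m≤n⇒m≤1+n (m≤n+m δ (toℕ j))) (m≤n+m _ (toℕ j))))
    (s≤s (≤-trans (m≤n+m δ (rest j)) (m≤m+n _ _)))
    (s≤s (≤-trans (m≤n+m δ (rest j)) (m≤m+n _ _)))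

  position-injective : ∀ k (j j′ : Fin s₂) → d₁ (inner (suc k) j) ≡ d₁ (inner (suc k) j′) →
                       d₂ (inner (suc k) j) ≡ d₂ (inner (suc k) j′) → j ≡ j′
  position-injective k j j′ d₁≡ d₂≡ = toℕ-injective (suc-injective (min-pair-injective (s≤s z≤n) sums d₁≡ d₂≡))
    where
    sums : suc (toℕ j) + suc (rest j) ≡ suc (toℕ j′) + suc (rest j′)
    sums = cong suc (trans (position+remaining {suc k} j) (sym (position+remaining {suc k} j′)))

  d₁d₂-injective-off : ∀ {x y} → OffLandmarkPaths x → OffLandmarkPaths y → d₁ x ≡ d₁ y → d₂ x ≡ d₂ y → x ≡ y
  d₁d₂-injective-off (on-short x) (on-short y) d₁≡ _ = d₁-injective-on-short x y d₁≡
  d₁d₂-injective-off (on-free j) (on-free j′) d₁≡ d₂≡ = cong (inner (suc zero)) (position-injective zero j j′ d₁≡ d₂≡)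
  d₁d₂-injective-off (on-free j) (on-short y) d₁≡ d₂≡ =
    contradiction (trans (cong₂ _+_ d₁≡ d₂≡) (d₁+d₂≡δ y)) (>⇒≢ (δ<d₁+d₂ zero j))
  d₁d₂-injective-off (on-short x) (on-free j) d₁≡ d₂≡ =
    contradiction (trans (sym (cong₂ _+_ d₁≡ d₂≡)) (d₁+d₂≡δ x)) (>⇒≢ (δ<d₁+d₂ zero j))

  data Away (k : Fin (suc (suc n))) : ThetaV → Set where
    off-landmark-paths : ∀ {x} → OffLandmarkPaths x → Away k x
    other-landmark-path : ∀ {k′} j → k′ ≢ k → Away k (inner (suc (suc k′)) j)

  dₗ-away : ∀ {k x} → Away k x → x ≢ c₂ → dₗ k x ≡ d₁ x + suc t
  dₗ-away {k} {x} away x≢c₂ = trans (dₗ≡dₗ-off-path away) (dₗ-off-path-via-c₁ x≢c₂)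
    where
    dₗ≡dₗ-off-path : ∀ {x} → Away k x → dₗ k x ≡ dₗ-off-path x
    dₗ≡dₗ-off-path (off-landmark-paths (on-short centre₁)) = refl
    dₗ≡dₗ-off-path (off-landmark-paths (on-short centre₂)) = refl
    dₗ≡dₗ-off-path (off-landmark-paths (on-short (short j))) = refl
    dₗ≡dₗ-off-path (off-landmark-paths (on-free j)) = refl
    dₗ≡dₗ-off-path (other-landmark-path j k′≢k) = dₗ-other-path≡ k _ j k′≢k

  dₗ≡⇒d₁≡ : ∀ {k u v} → Away k u → Away k v → u ≢ c₂ → v ≢ c₂ → dₗ k u ≡ dₗ k v → d₁ u ≡ d₁ v
  dₗ≡⇒d₁≡ {k} {u} {v} away-u away-v u≢c₂ v≢c₂ dₗ≡ =
    +-cancelʳ-≡ (suc t) (d₁ u) (d₁ v) (trans (sym (dₗ-away away-u u≢c₂)) (trans dₗ≡ (dₗ-away away-v v≢c₂)))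

  dₗ≡⇒d₁< : ∀ k j {v} → Away k v → v ≢ c₂ → dₗ k (inner (suc (suc k)) j) ≡ dₗ k v →
            d₁ v < d₁ (inner (suc (suc k)) j)
  dₗ≡⇒d₁< k j {v} away v≢c₂ dₗ≡ = +-cancelʳ-< (suc t) (d₁ v) _ (begin-strict
    d₁ v + suc t                          ≡⟨ sym (dₗ-away away v≢c₂) ⟩
    dₗ k v                                ≡⟨ sym dₗ≡ ⟩
    dₗ k (inner (suc (suc k)) j)          ≡⟨ dₗ-on-path≡ k j ⟩
    dₗ-on-path j                          <⟨ dₗ-on-path<via-c₁ k j ⟩
    d₁ (inner (suc (suc k)) j) + suc t    ∎)
    where open ≤-Reasoning

  other : Fin (suc (suc n)) → Fin (suc (suc n))
  other zero = suc zero
  other (suc _) = zero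

  other≢ : ∀ k → k ≢ other k
  other≢ zero ()
  other≢ (suc k) ()

  landmark-separates : ∀ {u v} → u ≢ v → u ≢ c₂ → v ≢ c₂ → d₂ u ≡ d₂ v → ∃ λ k → dₗ k u ≢ dₗ k v
  landmark-separates {u} {v} u≢v u≢c₂ v≢c₂ d₂≡ = separate (view u) (view v)
    where
    on-vs-off : ∀ k j {y} → OffLandmarkPaths y → y ≢ c₂ → ∃ λ k′ → dₗ k′ (inner (suc (suc k)) j) ≢ dₗ k′ y
    on-vs-off k j {y} off y≢c₂ with dₗ (other k) (inner (suc (suc k)) j) ≟ dₗ (other k) y
    ... | no dₗ≢ = other k , dₗ≢
    ... | yes dₗ≡ = k , λ dₗ≡′ → <-irrefl (sym d₁≡) (dₗ≡⇒d₁< k j (off-landmark-paths off) y≢c₂ dₗ≡′)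
      where
      d₁≡ : d₁ (inner (suc (suc k)) j) ≡ d₁ y
      d₁≡ = dₗ≡⇒d₁≡ (other-landmark-path j (other≢ k)) (off-landmark-paths off) (λ ()) y≢c₂ dₗ≡
    separate : View u → View v → ∃ λ k → dₗ k u ≢ dₗ k v
    separate (off-landmark-paths off-u) (off-landmark-paths off-v) = zero , λ dₗ≡ →
      u≢v (d₁d₂-injective-off off-u off-v
             (dₗ≡⇒d₁≡ (off-landmark-paths off-u) (off-landmark-paths off-v) u≢c₂ v≢c₂ dₗ≡) d₂≡)
    separate (on-landmark-path k j) (off-landmark-paths off-v) = on-vs-off k j off-v v≢c₂
    separate (off-landmark-paths off-u) (on-landmark-path k j) with on-vs-off k j off-u u≢c₂
    ... | k′ , dₗ≢ = k′ , λ dₗ≡ → dₗ≢ (sym dₗ≡)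
    separate (on-landmark-path k j) (on-landmark-path k′ j′) with k ≟ᶠ k′
    ... | yes refl = other k , λ dₗ≡ → u≢v (cong (inner (suc (suc k))) (position-injective (suc k) j j′
          (dₗ≡⇒d₁≡ (other-landmark-path j (other≢ k)) (other-landmark-path j′ (other≢ k)) u≢c₂ v≢c₂ dₗ≡) d₂≡))
    ... | no k≢k′ with dₗ k u ≟ dₗ k v
    ...   | no dₗ≢ = k , dₗ≢
    ...   | yes dₗ≡ = k′ , λ dₗ≡′ →
            <-asym (dₗ≡⇒d₁< k j (other-landmark-path j′ (k≢k′ ∘ sym)) v≢c₂ dₗ≡)
                   (dₗ≡⇒d₁< k′ j′ (other-landmark-path j k≢k′) u≢c₂ (sym dₗ≡′))

  landmarks : List ThetaV
  landmarks = c₂ ∷ map landmark (allFin (suc (suc n)))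

  landmarks-resolving : Resolving landmarks
  landmarks-resolving u v u≢v with d₂ u ≟ d₂ v
  ... | no d₂≢ = c₂ , here refl , d₂ u , d₂ v , d₂-IsDist u , d₂-IsDist v , d₂≢
  ... | yes d₂≡ with u ≟V c₂ | v ≟V c₂
  ...   | yes refl | _ = contradiction (sym (d₂≡0⇒c₂ (sym d₂≡))) u≢v
  ...   | no _ | yes refl = contradiction (d₂≡0⇒c₂ d₂≡) u≢v
  ...   | no u≢c₂ | no v≢c₂ with landmark-separates u≢v u≢c₂ v≢c₂ d₂≡
  ...     | k , dₗ≢ =
    landmark k , there (∈-map⁺ landmark (∈-allFin k)) , dₗ k u , dₗ k v , dₗ-IsDist k u , dₗ-IsDist k v , dₗ≢

  landmarks-unique : Unique landmarks
  landmarks-unique =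
    Allₚ.map⁺ (tabulate (λ _ ())) ∷ Uniqueₚ.map⁺ (λ { refl → refl }) (Uniqueₚ.allFin⁺ (suc (suc n)))

  length-landmarks : length landmarks ≡ m ∸ 1
  length-landmarks = cong suc (trans (length-map landmark (allFin (suc (suc n)))) (length-tabulate (λ k → k)))

mainTheorem11 : (m s₁ s₂ : ℕ) → 4 ≤ m → s₁ < s₂ →
    Σ ℕ λ b → Theta.IsMetricDim m (thetaLens s₁ s₂ m) b × m ∸ 2 ≤ b × b ≤ m ∸ 1
mainTheorem11 (suc (suc (suc (suc n)))) s₁ s₂ (s≤s (s≤s (s≤s (s≤s z≤n)))) s₁<s₂
  with s₂ ∸ suc s₁ | m+[n∸m]≡n s₁<s₂
... | e | refl =
  metricDim-squeeze (suc (suc n)) (resolvingSetOfSize? (suc (suc n)))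
    (λ W _ → LowerBound.resolving-size-≥ s₁ (s₁ + e) (suc (suc n)) W)
    (landmarks , landmarks-unique , landmarks-resolving , length-landmarks)
  where
  open UpperBound s₁ e n
  open ThetaFacts m len
  open FiniteGraph (Theta.Adj m len) _≟V_ adj? vertices ∈-vertices (connected zero)
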